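{- For every program $P$, all terms $s,t$ and all $w\in P^*$, if $s\hookrightarrow_w t$ then $\langle s\rangle\leadsto_w\langle t\rangle$.
   Context: $\Sigma$ is a signature, $X$ a countably infinite set of variables, $T(\Sigma,X)$ the set of terms, $\mathit{Var}$ the set of variables of a term or goal. Goals are finite sequences $\langle s_1,\dots,s_n\rangle$ of terms. Substitutions, renamings (bijective substitutions on $X$) and most general unifiers are as usual. A program is a set of rules $(u,\bar v)$, $u$ a term, $\bar v$ a goal. For a rule $r$: $\hookrightarrow_r=\{(u\theta,v\theta)\mid r=(u,\langle v\rangle),\ \mathit{Var}(v)\subseteq\mathit{Var}(u),\ \theta \text{ a substitution}\}$. For goals, $\bar s\leadsto_{r}\bar t$ iff $\bar s=\langle s_1,\dots,s_n\rangle$ and for some $1\le i\le n$ there are a renaming $\gamma$ with $(u',\langle v_1,\dots,v_m\rangle)=(u\gamma,\bar v\gamma)$ variable-disjoint from $\bar s$ (where $r=(u,\bar v)$) and a most general unifier $\sigma$ of $s_i$ and $u'$ with $\bar t=\langle s_1,\dots,s_{i-1},v_1,\dots,v_m,s_{i+1},\dots,s_n\rangle\sigma$. For $w=\langle r_1,\dots,r_n\rangle\in P^*$, $\hookrightarrow_w=\hookrightarrow_{r_1}\circ\cdots\circ\hookrightarrow_{r_n}$ and $\leadsto_w=\leadsto_{r_1}\circ\cdots\circ\leadsto_{r_n}$ (apply $r_1$ first); for $w=\epsilon$ both are the identity. -}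

module Defs where

open import Data.Nat using (ℕ)
open import Data.List using (List; []; _∷_; [_]; _++_; map)
open import Data.Vec using (Vec; []; _∷_)
open import Data.Product using (Σ; ∃; _×_; _,_)
open import Data.Empty using (⊥)
open import Relation.Nullary using (¬_)
open import Relation.Binary.PropositionalEquality using (_≡_)
open import Function.Definitions using (Bijective)

module Terms (F : Set) (ar : F → ℕ) where

  data Term : Set where
    var : ℕ → Term
    fun : (f : F) → Vec Term (ar f) → Term

  mutual
    data _occurs-in_ (x : ℕ) : Term → Set where
      here  : x occurs-in var x
      there : ∀ {f ts} → x occurs-in* ts → x occurs-in fun f ts

    data _occurs-in*_ (x : ℕ) : ∀ {n} → Vec Term n → Set where
      head : ∀ {n t} {ts : Vec Term n} → x occurs-in t → x occurs-in* (t ∷ ts)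
      tail : ∀ {n t} {ts : Vec Term n} → x occurs-in* ts → x occurs-in* (t ∷ ts)

  data _occurs-inG_ (x : ℕ) : List Term → Set where
    head : ∀ {t ts} → x occurs-in t → x occurs-inG (t ∷ ts)
    tail : ∀ {t ts} → x occurs-inG ts → x occurs-inG (t ∷ ts)

  Subst : Set
  Subst = ℕ → Term

  mutual
    _⟨_⟩ : Term → Subst → Term
    var x    ⟨ σ ⟩ = σ x
    fun f ts ⟨ σ ⟩ = fun f (ts ⟨ σ ⟩*)

    _⟨_⟩* : ∀ {n} → Vec Term n → Subst → Vec Term n
    []       ⟨ σ ⟩* = []
    (t ∷ ts) ⟨ σ ⟩* = (t ⟨ σ ⟩) ∷ (ts ⟨ σ ⟩*)

  _⟨_⟩G : List Term → Subst → List Term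
  g ⟨ σ ⟩G = map (_⟨ σ ⟩) g

  IsRenaming : Subst → Set
  IsRenaming γ = Σ (ℕ → ℕ) λ ρ → Bijective _≡_ _≡_ ρ × (∀ x → γ x ≡ var (ρ x))

  Unifier : Subst → Term → Term → Set
  Unifier σ s u = s ⟨ σ ⟩ ≡ u ⟨ σ ⟩

  IsMGU : Subst → Term → Term → Set
  IsMGU σ s u = Unifier σ s u ×
    (∀ θ → Unifier θ s u → Σ Subst λ δ → ∀ x → θ x ≡ (σ x) ⟨ δ ⟩)

  Rule : Set
  Rule = Term × List Term

  Program : Set₁
  Program = Rule → Set

  _↪[_]_ : Term → Rule → Term → Set
  s ↪[ (u , vs) ] t =
    Σ Term λ v → vs ≡ [ v ] × (∀ x → x occurs-in v → x occurs-in u) ×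
      Σ Subst λ θ → s ≡ u ⟨ θ ⟩ × t ≡ v ⟨ θ ⟩

  _⇝[_]_ : List Term → Rule → List Term → Set
  ss ⇝[ (u , vs) ] ts =
    Σ (List Term) λ pre → Σ Term λ si → Σ (List Term) λ suf →
      ss ≡ pre ++ si ∷ suf ×
      Σ Subst λ γ → IsRenaming γ ×
        (∀ x → x occurs-inG ((u ⟨ γ ⟩) ∷ (vs ⟨ γ ⟩G)) → ¬ (x occurs-inG ss)) ×
        Σ Subst λ σ → IsMGU σ si (u ⟨ γ ⟩) ×
          ts ≡ (pre ++ (vs ⟨ γ ⟩G) ++ suf) ⟨ σ ⟩G

  data _↪*[_]_ : Term → List Rule → Term → Set where
    ε   : ∀ {s} → s ↪*[ [] ] s
    _▸_ : ∀ {s s' t r w} → s ↪[ r ] s' → s' ↪*[ w ] t → s ↪*[ r ∷ w ] t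

  data _⇝*[_]_ : List Term → List Rule → List Term → Set where
    ε   : ∀ {s} → s ⇝*[ [] ] s
    _▸_ : ∀ {s s' t r w} → s ⇝[ r ] s' → s' ⇝*[ w ] t → s ⇝*[ r ∷ w ] t

{-# OPTIONS --safe #-}
module Submission where

-- A rewrite step s = uθ ↪ vθ becomes a resolution step once the rule is renamed
-- apart from s: choose an involutive renaming γ that moves every variable of u
-- above all variables of s and u. Then uγ matches s via τ = γ ; θ, and since s
-- and uγ share no variables, τ restricted to the variables of uγ is a most general
-- unifier of s and uγ which fixes s. It sends vγ to vθ because Var(v) ⊆ Var(u).

open import Defs
open import Data.Nat using (ℕ; _+_; _∸_; _<_; _≤_; _⊔_; _<?_; _≟_)
open import Data.Nat.Properties
  using (≤-refl; <-≤-trans; m≤m⊔n; m≤n⊔m; m≤n+m; m+n≮n; m+n∸n≡m; m∸n+n≡m; ≮⇒≥; <⇒≱)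
open import Data.List using (List; []; _∷_; [_])
open import Data.List.Relation.Unary.All using (All)
open import Data.Vec using (Vec; []; _∷_)
open import Data.Product using (∃; _×_; _,_)
open import Data.Sum using (inj₁; inj₂)
open import Function using (_∘_)
open import Function.Consequences.Propositional
  using (inverseᵇ⇒bijective; strictlyInverseˡ⇒inverseˡ; strictlyInverseʳ⇒inverseʳ)
open import Relation.Nullary using (¬_; Dec; yes; no; contradiction)
open import Relation.Nullary.Decidable using (map′; _⊎-dec_)
open import Relation.Binary.PropositionalEquality
  using (_≡_; refl; sym; trans; cong; cong₂; subst; module ≡-Reasoning)

module BlockSwap (B : ℕ) where

  swap : ℕ → ℕ
  swap y with y <? B
  ... | yes _ = y + B
  ... | no _ with y ∸ B <? B
  ...   | yes _ = y ∸ B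
  ...   | no _  = y

  swap-low : ∀ {y} → y < B → swap y ≡ y + B
  swap-low {y} y<B with y <? B
  ... | yes _  = refl
  ... | no y≮B = contradiction y<B y≮B

  swap-shifted : ∀ {y} → y < B → swap (y + B) ≡ y
  swap-shifted {y} y<B with y + B <? B
  ... | yes y+B<B = contradiction y+B<B (m+n≮n y B)
  ... | no _ with y + B ∸ B <? B
  ...   | yes _ = m+n∸n≡m y B
  ...   | no ≮B = contradiction (subst (_< B) (sym (m+n∸n≡m y B)) y<B) ≮B

  swap-fixed : ∀ {y} → ¬ y < B → ¬ y ∸ B < B → swap y ≡ y
  swap-fixed {y} y≮B y∸B≮B with y <? B
  ... | yes y<B = contradiction y<B y≮B
  ... | no _ with y ∸ B <? B
  ...   | yes y∸B<B = contradiction y∸B<B y∸B≮B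
  ...   | no _      = refl

  swap-involutive : ∀ y → swap (swap y) ≡ y
  swap-involutive y with y <? B
  ... | yes y<B = swap-shifted y<B
  ... | no y≮B with y ∸ B <? B
  ...   | yes y∸B<B = trans (swap-low y∸B<B) (m∸n+n≡m (≮⇒≥ y≮B))
  ...   | no y∸B≮B = swap-fixed y≮B y∸B≮B

  swap-raises-low : ∀ {y} → y < B → B ≤ swap y
  swap-raises-low {y} y<B = subst (B ≤_) (sym (swap-low y<B)) (m≤n+m B y)

module TermProperties (F : Set) (ar : F → ℕ) where
  open Terms F ar

  _⊆ⱽ_ : Term → Term → Set
  v ⊆ⱽ u = ∀ x → x occurs-in v → x occurs-in u

  Apart : Term → Term → Set
  Apart s u = ∀ x → x occurs-in s → ¬ x occurs-in u

  _⨾_ : Subst → Subst → Subst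
  (σ ⨾ τ) x = σ x ⟨ τ ⟩

  mutual
    _occurs-in?_ : ∀ x t → Dec (x occurs-in t)
    x occurs-in? var y    = map′ (λ { refl → here }) (λ { here → refl }) (x ≟ y)
    x occurs-in? fun f ts = map′ there (λ { (there p) → p }) (x occurs-in*? ts)

    _occurs-in*?_ : ∀ x {n} (ts : Vec Term n) → Dec (x occurs-in* ts)
    x occurs-in*? []       = no λ ()
    x occurs-in*? (t ∷ ts) =
      map′ (λ { (inj₁ p) → head p ; (inj₂ p) → tail p })
           (λ { (head p) → inj₁ p ; (tail p) → inj₂ p })
           (x occurs-in? t ⊎-dec x occurs-in*? ts)

  mutual
    varBound : Term → ℕ
    varBound (var x)    = ℕ.suc x
    varBound (fun f ts) = varBound* ts

    varBound* : ∀ {n} → Vec Term n → ℕ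
    varBound* []       = 0
    varBound* (t ∷ ts) = varBound t ⊔ varBound* ts

  mutual
    occurs⇒<varBound : ∀ {x t} → x occurs-in t → x < varBound t
    occurs⇒<varBound here      = ≤-refl
    occurs⇒<varBound (there p) = occurs*⇒<varBound* p

    occurs*⇒<varBound* : ∀ {x n} {ts : Vec Term n} → x occurs-in* ts → x < varBound* ts
    occurs*⇒<varBound* {ts = t ∷ ts} (head p) = <-≤-trans (occurs⇒<varBound p) (m≤m⊔n _ (varBound* ts))
    occurs*⇒<varBound* {ts = t ∷ ts} (tail p) = <-≤-trans (occurs*⇒<varBound* p) (m≤n⊔m (varBound t) _)

  mutual
    ⟨⟩-cong-on : ∀ {σ τ} t → (∀ x → x occurs-in t → σ x ≡ τ x) → t ⟨ σ ⟩ ≡ t ⟨ τ ⟩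
    ⟨⟩-cong-on (var x)    σ≡τ = σ≡τ x here
    ⟨⟩-cong-on (fun f ts) σ≡τ = cong (fun f) (⟨⟩*-cong-on ts (λ x → σ≡τ x ∘ there))

    ⟨⟩*-cong-on : ∀ {σ τ n} (ts : Vec Term n) → (∀ x → x occurs-in* ts → σ x ≡ τ x) → ts ⟨ σ ⟩* ≡ ts ⟨ τ ⟩*
    ⟨⟩*-cong-on []       σ≡τ = refl
    ⟨⟩*-cong-on (t ∷ ts) σ≡τ = cong₂ _∷_ (⟨⟩-cong-on t (λ x → σ≡τ x ∘ head)) (⟨⟩*-cong-on ts (λ x → σ≡τ x ∘ tail))

  mutual
    ⟨⟩-injective-on : ∀ {σ τ} t → t ⟨ σ ⟩ ≡ t ⟨ τ ⟩ → ∀ x → x occurs-in t → σ x ≡ τ x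
    ⟨⟩-injective-on (var y)    eq .y here      = eq
    ⟨⟩-injective-on (fun f ts) eq x  (there p) = ⟨⟩*-injective-on ts (fun-injective eq) x p
      where
      fun-injective : ∀ {as bs : Vec Term (ar f)} → fun f as ≡ fun f bs → as ≡ bs
      fun-injective refl = refl

    ⟨⟩*-injective-on : ∀ {σ τ n} (ts : Vec Term n) → ts ⟨ σ ⟩* ≡ ts ⟨ τ ⟩* → ∀ x → x occurs-in* ts → σ x ≡ τ x
    ⟨⟩*-injective-on (t ∷ ts) eq x (head p) = ⟨⟩-injective-on t (cong Data.Vec.head eq) x p
    ⟨⟩*-injective-on (t ∷ ts) eq x (tail p) = ⟨⟩*-injective-on ts (cong Data.Vec.tail eq) x p

  mutual
    ⟨⟩-⨾ : ∀ σ τ t → t ⟨ σ ⟩ ⟨ τ ⟩ ≡ t ⟨ σ ⨾ τ ⟩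
    ⟨⟩-⨾ σ τ (var x)    = refl
    ⟨⟩-⨾ σ τ (fun f ts) = cong (fun f) (⟨⟩*-⨾ σ τ ts)

    ⟨⟩*-⨾ : ∀ σ τ {n} (ts : Vec Term n) → ts ⟨ σ ⟩* ⟨ τ ⟩* ≡ ts ⟨ σ ⨾ τ ⟩*
    ⟨⟩*-⨾ σ τ []       = refl
    ⟨⟩*-⨾ σ τ (t ∷ ts) = cong₂ _∷_ (⟨⟩-⨾ σ τ t) (⟨⟩*-⨾ σ τ ts)

  ⟨⟩-identity-on : ∀ {σ} t → (∀ x → x occurs-in t → σ x ≡ var x) → t ⟨ σ ⟩ ≡ t
  ⟨⟩-identity-on t σ≡var = trans (⟨⟩-cong-on t σ≡var) (identity t)
    where
    mutual
      identity : ∀ t → t ⟨ var ⟩ ≡ t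
      identity (var x)    = refl
      identity (fun f ts) = cong (fun f) (identity* ts)

      identity* : ∀ {n} (ts : Vec Term n) → ts ⟨ var ⟩* ≡ ts
      identity* []       = refl
      identity* (t ∷ ts) = cong₂ _∷_ (identity t) (identity* ts)

  mutual
    ⟨⟩-occurs : ∀ {x τ} t → x occurs-in (t ⟨ τ ⟩) → ∃ λ y → y occurs-in t × x occurs-in τ y
    ⟨⟩-occurs (var y)    p         = y , here , p
    ⟨⟩-occurs (fun f ts) (there p) with ⟨⟩*-occurs ts p
    ... | y , q , r = y , there q , r

    ⟨⟩*-occurs : ∀ {x τ n} (ts : Vec Term n) → x occurs-in* (ts ⟨ τ ⟩*) → ∃ λ y → y occurs-in* ts × x occurs-in τ y
    ⟨⟩*-occurs (t ∷ ts) (head p) with ⟨⟩-occurs t p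
    ... | y , q , r = y , head q , r
    ⟨⟩*-occurs (t ∷ ts) (tail p) with ⟨⟩*-occurs ts p
    ... | y , q , r = y , tail q , r

  mutual
    occurs-⟨⟩ : ∀ {x y τ t} → y occurs-in t → x occurs-in τ y → x occurs-in (t ⟨ τ ⟩)
    occurs-⟨⟩ here      r = r
    occurs-⟨⟩ (there q) r = there (occurs*-⟨⟩ q r)

    occurs*-⟨⟩ : ∀ {x y τ n} {ts : Vec Term n} → y occurs-in* ts → x occurs-in τ y → x occurs-in* (ts ⟨ τ ⟩*)
    occurs*-⟨⟩ (head q) r = head (occurs-⟨⟩ q r)
    occurs*-⟨⟩ (tail q) r = tail (occurs*-⟨⟩ q r)

  ⟨⟩-mono-⊆ⱽ : ∀ {v u} τ → v ⊆ⱽ u → (v ⟨ τ ⟩) ⊆ⱽ (u ⟨ τ ⟩)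
  ⟨⟩-mono-⊆ⱽ {v} τ v⊆u x p with ⟨⟩-occurs v p
  ... | y , q , r = occurs-⟨⟩ (v⊆u y q) r

  involution⇒renaming : ∀ {ρ : ℕ → ℕ} → (∀ y → ρ (ρ y) ≡ y) → IsRenaming (var ∘ ρ)
  involution⇒renaming {ρ} ρρ =
    ρ , inverseᵇ⇒bijective (strictlyInverseˡ⇒inverseˡ ρ ρρ , strictlyInverseʳ⇒inverseʳ ρ ρρ) , λ _ → refl

  _↾_ : Subst → Term → Subst
  (τ ↾ u) x with x occurs-in? u
  ... | yes _ = τ x
  ... | no _  = var x

  ↾-inside : ∀ {τ u x} → x occurs-in u → (τ ↾ u) x ≡ τ x
  ↾-inside {u = u} {x} p with x occurs-in? u
  ... | yes _ = refl
  ... | no ¬p = contradiction p ¬p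

  ↾-outside : ∀ {τ u x} → ¬ x occurs-in u → (τ ↾ u) x ≡ var x
  ↾-outside {u = u} {x} ¬p with x occurs-in? u
  ... | yes p = contradiction p ¬p
  ... | no _  = refl

  apart-matcher-isMGU : ∀ {s u τ} → Apart s u → s ≡ u ⟨ τ ⟩ → IsMGU (τ ↾ u) s u
  apart-matcher-isMGU {s} {u} {τ} s#u s≡uτ = unifies , mostGeneral
    where
    open ≡-Reasoning

    unifies : s ⟨ τ ↾ u ⟩ ≡ u ⟨ τ ↾ u ⟩
    unifies = begin
      s ⟨ τ ↾ u ⟩ ≡⟨ ⟨⟩-identity-on s (λ x p → ↾-outside (s#u x p)) ⟩
      s           ≡⟨ s≡uτ ⟩
      u ⟨ τ ⟩     ≡⟨ ⟨⟩-cong-on u (λ x p → sym (↾-inside p)) ⟩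
      u ⟨ τ ↾ u ⟩ ∎

    mostGeneral : ∀ θ → Unifier θ s u → ∃ λ δ → ∀ x → θ x ≡ (τ ↾ u) x ⟨ δ ⟩
    mostGeneral θ sθ≡uθ = θ , factor
      where
      uθ≡uτθ : u ⟨ θ ⟩ ≡ u ⟨ τ ⨾ θ ⟩
      uθ≡uτθ = begin
        u ⟨ θ ⟩         ≡⟨ sym sθ≡uθ ⟩
        s ⟨ θ ⟩         ≡⟨ cong _⟨ θ ⟩ s≡uτ ⟩
        u ⟨ τ ⟩ ⟨ θ ⟩   ≡⟨ ⟨⟩-⨾ τ θ u ⟩
        u ⟨ τ ⨾ θ ⟩     ∎

      factor : ∀ x → θ x ≡ (τ ↾ u) x ⟨ θ ⟩
      factor x with x occurs-in? u
      ... | yes p = ⟨⟩-injective-on u uθ≡uτθ x p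
      ... | no _  = refl

  module _ (s u : Term) where
    open BlockSwap (varBound s ⊔ varBound u)

    swap-apart : Apart s (u ⟨ var ∘ swap ⟩)
    swap-apart x x∈s x∈uγ with ⟨⟩-occurs u x∈uγ
    ... | y , y∈u , here = <⇒≱ (<-≤-trans (occurs⇒<varBound x∈s) (m≤m⊔n _ (varBound u)))
                               (swap-raises-low (<-≤-trans (occurs⇒<varBound y∈u) (m≤n⊔m (varBound s) _)))

  ↪⇒⇝ : ∀ {s t r} → s ↪[ r ] t → [ s ] ⇝[ r ] [ t ]
  ↪⇒⇝ {r = u , _} (v , refl , v⊆u , θ , refl , refl) =
    [] , s , [] , refl , γ , involution⇒renaming swap-involutive , goals-apart ,
    τ ↾ uγ , apart-matcher-isMGU s#uγ (sym (unrename u)) , cong [_] vθ≡vγσ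
    where
    open ≡-Reasoning
    s = u ⟨ θ ⟩
    open BlockSwap (varBound s ⊔ varBound u)

    γ τ : Subst
    γ = var ∘ swap
    τ = γ ⨾ θ

    uγ vγ : Term
    uγ = u ⟨ γ ⟩
    vγ = v ⟨ γ ⟩

    s#uγ : Apart s uγ
    s#uγ = swap-apart s u

    vγ⊆uγ : vγ ⊆ⱽ uγ
    vγ⊆uγ = ⟨⟩-mono-⊆ⱽ γ v⊆u

    unrename : ∀ t → t ⟨ γ ⟩ ⟨ τ ⟩ ≡ t ⟨ θ ⟩
    unrename t = trans (⟨⟩-⨾ γ τ t) (⟨⟩-cong-on t (λ y _ → cong θ (swap-involutive y)))

    goals-apart : ∀ x → x occurs-inG (uγ ∷ [ vγ ]) → ¬ x occurs-inG [ s ]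
    goals-apart x (head p)        (head q) = s#uγ x q p
    goals-apart x (tail (head p)) (head q) = s#uγ x q (vγ⊆uγ x p)
    goals-apart x (tail (tail ())) _
    goals-apart x _ (tail ())

    vθ≡vγσ : v ⟨ θ ⟩ ≡ vγ ⟨ τ ↾ uγ ⟩
    vθ≡vγσ = begin
      v ⟨ θ ⟩          ≡⟨ sym (unrename v) ⟩
      vγ ⟨ τ ⟩         ≡⟨ ⟨⟩-cong-on vγ (λ x p → sym (↾-inside (vγ⊆uγ x p))) ⟩
      vγ ⟨ τ ↾ uγ ⟩    ∎

  ↪*⇒⇝* : ∀ {s t w} → s ↪*[ w ] t → [ s ] ⇝*[ w ] [ t ]
  ↪*⇒⇝* ε              = ε
  ↪*⇒⇝* (step ▸ steps) = ↪⇒⇝ step ▸ ↪*⇒⇝* steps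

lemma6 : (F : Set) (ar : F → ℕ) → let open Terms F ar in
    (P : Program) (s t : Term) (w : List Rule) → All P w →
    s ↪*[ w ] t → [ s ] ⇝*[ w ] [ t ]
lemma6 F ar _ _ _ _ _ = TermProperties.↪*⇒⇝* F ar
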